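{- In the !FMC over a signature with no computation constants and whose only value constants have base type, machine equivalence $\sim$ is a congruence relation on typed terms: it is reflexive, symmetric and transitive, and if two terms are machine equivalent then placing them in the same term context yields machine equivalent terms.
   Context: Locations $A$ with main location $\lambda$. Value types $t::=\alpha\mid[\sigma\Rightarrow\tau]$ over base types; stack types are finite sequences of value types (bottom to top); memory types $\sigma=(\sigma_a)_{a\in A}$ (finitely many nonempty), $\sigma\tau$ pointwise concatenation, $a(r)$ the memory type with $r$ at $a$ and empty elsewhere. Terms: computations $M::=*\mid [V]a.M\mid a\langle x\rangle.M\mid ?V.M$, values $V::=x\mid v\mid !M$ ($v$ value constants of base type). Sequencing: $*;M=M$, $([V]a.N);M=[V]a.(N;M)$, $(a\langle x\rangle.N);M=a\langle x\rangle.(N;M)$ (avoiding capture), $(?V.N);M=?V.(N;M)$. Typing: $*:[\tau\Rightarrow\tau]$; $V:r$, $M:[\sigma\,a(r)\Rightarrow\tau]$ give $[V]a.M:[\sigma\Rightarrow\tau]$; $x:r,\Gamma\vdash M:[\sigma\Rightarrow\tau]$ gives $a\langle x\rangle.M:[\sigma\,a(r)\Rightarrow\tau]$; $M:[\sigma\Rightarrow\tau]$ gives $!M:[\sigma\Rightarrow\tau]$; $V:[\rho\Rightarrow\sigma]$, $M:[\tau\sigma\Rightarrow\upsilon]$ give $?V.M:[\tau\rho\Rightarrow\upsilon]$; variables and constants have their declared types. Machine: a memory is a family of stacks of closed values; a state is $(S_A,M)$; transitions: $(S_A,[V]a.M)\to(S_A\text{ with }V\text{ pushed on }S_a, M)$;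 $(S_A\text{ with }V\text{ on top of }S_a, a\langle x\rangle.M)\to(S_A\text{ with it popped},\{V/x\}M)$; $(S_A,?(!N).M)\to(S_A,N;M)$. For closed $M:[\sigma\Rightarrow\tau]$ and memory $S_A:\sigma$ the run reaches $(T_A,*)$; write $(S_A,M)\Downarrow=T_A$. Machine equivalence (by induction on types): closed $M\sim M':[\sigma\Rightarrow\tau]$ iff for all memories $S_A\sim S'_A:\sigma$, $(S_A,M)\Downarrow\sim(S'_A,M')\Downarrow:\tau$; closed values $V\sim V':[\sigma\Rightarrow\tau]$ iff $?V\sim ?V'$; at base type, $v\sim v'$ iff identical constants; memories equivalent iff values pairwise equivalent; for open terms, equivalence means equivalence after substituting any pairwise-equivalent closed values for the free variables. -}

module Defs where

open import Data.Nat using (ℕ; zero; suc)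
open import Data.Fin using (Fin)
open import Data.List using (List; []; _∷_; _++_; [_])
open import Data.Vec using (Vec; []; _∷_; zipWith; replicate; lookup; _[_]≔_; _[_]%=_)
open import Data.Product using (Σ; _×_; _,_)
open import Data.Unit using (⊤)
open import Data.Empty using (⊥)
open import Relation.Binary.PropositionalEquality using (_≡_)
open import Relation.Binary.Construct.Closure.ReflexiveTransitive using (Star)

-- The sequential !FMC (stack machine fragment) over:
--   * n locations A = Fin n, with main location mainLoc,
--   * a set B of base types,
--   * a set K of value constants, each of base type (κ k), and no
--     computation constants.
module FMC (n : ℕ) (mainLoc : Fin n) (B : Set) (K : Set) (κ : K → B) where

  -- value types t ::= α | [σ ⇒ τ]; stack types are lists (bottom to top,
  -- i.e. the LAST element is the top); memory types assign a stack type to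
  -- each of the (finitely many) locations.
  data Ty : Set where
    base : B → Ty
    arr  : Vec (List Ty) n → Vec (List Ty) n → Ty

  StackTy : Set
  StackTy = List Ty

  MemTy : Set
  MemTy = Vec StackTy n

  _⊗_ : MemTy → MemTy → MemTy
  σ ⊗ τ = zipWith _++_ σ τ

  infixl 5 _⊗_

  loc : Fin n → Ty → MemTy
  loc a r = replicate n [] [ a ]≔ [ r ]

  -- Terms (de Bruijn indices; a⟨x⟩.M binds index 0 in M)

  mutual
    data Comp : Set where
      ⋆     : Comp
      push  : Val → Fin n → Comp → Comp
      pop   : Fin n → Comp → Comp
      force : Val → Comp → Comp

    data Val : Set where
      var  : ℕ → Val
      con  : K → Val
      bang : Comp → Val

  ext : (ℕ → ℕ) → ℕ → ℕ
  ext ρ zero    = zero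
  ext ρ (suc i) = suc (ρ i)

  mutual
    renC : (ℕ → ℕ) → Comp → Comp
    renC ρ ⋆             = ⋆
    renC ρ (push V a M)  = push (renV ρ V) a (renC ρ M)
    renC ρ (pop a M)     = pop a (renC (ext ρ) M)
    renC ρ (force V M)   = force (renV ρ V) (renC ρ M)

    renV : (ℕ → ℕ) → Val → Val
    renV ρ (var i)  = var (ρ i)
    renV ρ (con k)  = con k
    renV ρ (bang M) = bang (renC ρ M)

  exts : (ℕ → Val) → ℕ → Val
  exts γ zero    = var zero
  exts γ (suc i) = renV suc (γ i)

  mutual
    subC : (ℕ → Val) → Comp → Comp
    subC γ ⋆            = ⋆
    subC γ (push V a M) = push (subV γ V) a (subC γ M)
    subC γ (pop a M)    = pop a (subC (exts γ) M)
    subC γ (force V M)  = force (subV γ V) (subC γ M)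

    subV : (ℕ → Val) → Val → Val
    subV γ (var i)  = γ i
    subV γ (con k)  = con k
    subV γ (bang M) = bang (subC γ M)

  sub1 : Val → Comp → Comp
  sub1 V M = subC σ M
    where
      σ : ℕ → Val
      σ zero    = V
      σ (suc i) = var i

  -- sequencing N ; M  (capture-avoiding via shifting)
  _︔_ : Comp → Comp → Comp
  ⋆            ︔ M = M
  push V a N   ︔ M = push V a (N ︔ M)
  pop a N      ︔ M = pop a (N ︔ renC suc M)
  force V N    ︔ M = force V (N ︔ M)

  Ctx : Set
  Ctx = List Ty   -- head = most recently bound variable (index 0)

  data _∋_∶_ : Ctx → ℕ → Ty → Set where
    here  : ∀ {Γ t} → (t ∷ Γ) ∋ zero ∶ t
    there : ∀ {Γ t u i} → Γ ∋ i ∶ t → (u ∷ Γ) ∋ suc i ∶ t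

  mutual
    data _⊢C_∶_⇒_ (Γ : Ctx) : Comp → MemTy → MemTy → Set where
      ⊢⋆     : ∀ {τ} → Γ ⊢C ⋆ ∶ τ ⇒ τ
      ⊢push  : ∀ {V a M r σ τ} → Γ ⊢V V ∶ r → Γ ⊢C M ∶ (σ ⊗ loc a r) ⇒ τ
             → Γ ⊢C push V a M ∶ σ ⇒ τ
      ⊢pop   : ∀ {a M r σ τ} → (r ∷ Γ) ⊢C M ∶ σ ⇒ τ
             → Γ ⊢C pop a M ∶ (σ ⊗ loc a r) ⇒ τ
      ⊢force : ∀ {V M ρ σ τ υ} → Γ ⊢V V ∶ arr ρ σ → Γ ⊢C M ∶ (τ ⊗ σ) ⇒ υ
             → Γ ⊢C force V M ∶ (τ ⊗ ρ) ⇒ υ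

    data _⊢V_∶_ (Γ : Ctx) : Val → Ty → Set where
      ⊢var  : ∀ {i t} → Γ ∋ i ∶ t → Γ ⊢V var i ∶ t
      ⊢con  : ∀ {k} → Γ ⊢V con k ∶ base (κ k)
      ⊢bang : ∀ {M σ τ} → Γ ⊢C M ∶ σ ⇒ τ → Γ ⊢V bang M ∶ arr σ τ

  Stack : Set
  Stack = List Val   -- last element = top

  Mem : Set
  Mem = Vec Stack n

  State : Set
  State = Mem × Comp

  data _↦_ : State → State → Set where
    step-push  : ∀ {S V a M} →
                 (S , push V a M) ↦ ((S [ a ]%= (λ s → s ++ [ V ])) , M)
    step-pop   : ∀ {S a M s V} → lookup S a ≡ s ++ [ V ] →
                 (S , pop a M) ↦ ((S [ a ]≔ s) , sub1 V M)
    step-force : ∀ {S N M} →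
                 (S , force (bang N) M) ↦ (S , (N ︔ M))

  Run : Mem → Comp → Mem → Set
  Run S M T = Star _↦_ (S , M) (T , ⋆)

  mutual
    ValEq : Ty → Val → Val → Set
    ValEq (base β)  V V' = Σ K (λ k → κ k ≡ β × V ≡ con k × V' ≡ con k)
    ValEq (arr σ τ) V V' = CompEq σ τ (force V ⋆) (force V' ⋆)

    CompEq : MemTy → MemTy → Comp → Comp → Set
    CompEq σ τ M M' =
      ([] ⊢C M ∶ σ ⇒ τ) × ([] ⊢C M' ∶ σ ⇒ τ) ×
      (∀ S S' → MemEq σ S S' → ∀ T T' → Run S M T → Run S' M' T' → MemEq τ T T')

    MemEq : ∀ {m} → Vec StackTy m → Vec Stack m → Vec Stack m → Set
    MemEq []      []      []        = ⊤
    MemEq (s ∷ σ) (S ∷ Ss) (S' ∷ Ss') = StackEq s S S' × MemEq σ Ss Ss'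

    StackEq : StackTy → Stack → Stack → Set
    StackEq []       []       []        = ⊤
    StackEq (t ∷ ts) (V ∷ Vs) (V' ∷ Vs') = ValEq t V V' × StackEq ts Vs Vs'
    StackEq _        _        _         = ⊥

  SubEq : Ctx → (ℕ → Val) → (ℕ → Val) → Set
  SubEq Γ γ γ' = ∀ {i t} → Γ ∋ i ∶ t → ValEq t (γ i) (γ' i)

  data Sort : Set where
    comp val : Sort

  Tm : Sort → Set
  Tm comp = Comp
  Tm val  = Val

  Typ : Sort → Set
  Typ comp = MemTy × MemTy
  Typ val  = Ty

  _⊢[_]_∶_ : Ctx → (s : Sort) → Tm s → Typ s → Set
  Γ ⊢[ comp ] M ∶ (σ , τ) = Γ ⊢C M ∶ σ ⇒ τ
  Γ ⊢[ val  ] V ∶ t       = Γ ⊢V V ∶ t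

  subst : (s : Sort) → (ℕ → Val) → Tm s → Tm s
  subst comp γ M = subC γ M
  subst val  γ V = subV γ V

  ClosedEq : (s : Sort) → Typ s → Tm s → Tm s → Set
  ClosedEq comp (σ , τ) M M' = CompEq σ τ M M'
  ClosedEq val  t       V V' = ValEq t V V'

  Equiv : (s : Sort) → Ctx → Typ s → Tm s → Tm s → Set
  Equiv s Γ T X X' =
    (Γ ⊢[ s ] X ∶ T) × (Γ ⊢[ s ] X' ∶ T) ×
    (∀ γ γ' → SubEq Γ γ γ' → ClosedEq s T (subst s γ X) (subst s γ' X'))

  data TC (h : Sort) : Sort → Set where
    hole    : TC h h
    push-v  : TC h val → Fin n → Comp → TC h comp
    push-c  : Val → Fin n → TC h comp → TC h comp
    pop     : Fin n → TC h comp → TC h comp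
    force-v : TC h val → Comp → TC h comp
    force-c : Val → TC h comp → TC h comp
    bang    : TC h comp → TC h val

  plug : ∀ {h s} → TC h s → Tm h → Tm s
  plug hole          X = X
  plug (push-v C a M) X = push (plug C X) a M
  plug (push-c V a C) X = push V a (plug C X)
  plug (pop a C)      X = pop a (plug C X)
  plug (force-v C M)  X = force (plug C X) M
  plug (force-c V C)  X = force V (plug C X)
  plug (bang C)       X = bang (plug C X)

  -- Context typing: TCTy Δ T Γ C T' means that C is a well-typed context
  -- with hole Δ ⊢ _ : T, and Γ ⊢ C[_] : T'.
  data TCTy {h : Sort} (Δ : Ctx) (T : Typ h) : (Γ : Ctx) → {s : Sort} → TC h s → Typ s → Set where
    ty-hole    : TCTy Δ T Δ hole T
    ty-push-v  : ∀ {Γ C a M r σ τ} → TCTy Δ T Γ C r → Γ ⊢C M ∶ (σ ⊗ loc a r) ⇒ τ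
               → TCTy Δ T Γ (push-v C a M) (σ , τ)
    ty-push-c  : ∀ {Γ V a C r σ τ} → Γ ⊢V V ∶ r → TCTy Δ T Γ C (σ ⊗ loc a r , τ)
               → TCTy Δ T Γ (push-c V a C) (σ , τ)
    ty-pop     : ∀ {Γ a C r σ τ} → TCTy Δ T (r ∷ Γ) C (σ , τ)
               → TCTy Δ T Γ (pop a C) (σ ⊗ loc a r , τ)
    ty-force-v : ∀ {Γ C M ρ σ τ υ} → TCTy Δ T Γ C (arr ρ σ) → Γ ⊢C M ∶ (τ ⊗ σ) ⇒ υ
               → TCTy Δ T Γ (force-v C M) (τ ⊗ ρ , υ)
    ty-force-c : ∀ {Γ V C ρ σ τ υ} → Γ ⊢V V ∶ arr ρ σ → TCTy Δ T Γ C (τ ⊗ σ , υ)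
               → TCTy Δ T Γ (force-c V C) (τ ⊗ ρ , υ)
    ty-bang    : ∀ {Γ C σ τ} → TCTy Δ T Γ C (σ , τ)
               → TCTy Δ T Γ (bang C) (arr σ τ)

  record IsCongruence : Set₁ where
    field
      reflexive  : ∀ s Γ (T : Typ s) (X : Tm s) → Γ ⊢[ s ] X ∶ T → Equiv s Γ T X X
      symmetric  : ∀ s Γ (T : Typ s) (X Y : Tm s) → Equiv s Γ T X Y → Equiv s Γ T Y X
      transitive : ∀ s Γ (T : Typ s) (X Y Z : Tm s) →
                   Equiv s Γ T X Y → Equiv s Γ T Y Z → Equiv s Γ T X Z
      congruent  : ∀ h s Δ (T : Typ h) Γ (T' : Typ s) (C : TC h s) (X Y : Tm h) →
                   TCTy Δ T Γ C T' → Equiv h Δ T X Y →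
                   Equiv s Γ T' (plug C X) (plug C Y)

{-# OPTIONS --safe #-}
module Submission where

-- Machine equivalence is a binary logical relation, so symmetry follows by induction on types.
-- Transitivity does not: comparing M₁ with M₃ on memories S ∼ S₃ requires a run of the middle
-- term M₂ from S₃, i.e. termination of the machine, which is proved separately with a unary
-- logical predicate RedV and its fundamental lemma. Reflexivity is the fundamental lemma of the
-- binary relation, proved one term former at a time. The only non-local case is ?V.M on a memory
-- of type τρ, which is (?V.*) ; M: runs of a sequence split where the first part ends, and
-- forcing V is compatible with the frame τ because, by termination and determinism, a run from
-- F ⊕ X is the run from X with F left untouched underneath. Congruence then follows by induction
-- on the context, with reflexivity for the parts of the context outside the hole.

open import Defs
open import Data.Nat using (ℕ; zero; suc)
open import Data.Fin using (Fin; zero; suc)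
open import Data.List using (List; []; _∷_; _++_; [_])
open import Data.List.Properties using (++-assoc; ++-identityˡ; ++-identityʳ; ∷ʳ-injective)
open import Data.Vec using (Vec; []; _∷_; zipWith; replicate; lookup; _[_]≔_; _[_]%=_)
open import Data.Vec.Properties using (zipWith-assoc; zipWith-identityˡ; zipWith-identityʳ; lookup-zipWith)
open import Data.Product using (Σ; _×_; _,_; proj₁; proj₂)
open import Data.Unit using (⊤; tt)
open import Data.Empty using (⊥)
open import Function using (_∘_; id)
open import Relation.Binary.PropositionalEquality
  using (_≡_; _≗_; refl; sym; trans; cong; cong₂; subst; subst₂; module ≡-Reasoning)
open import Relation.Binary.Construct.Closure.ReflexiveTransitive using (Star; ε; _◅_)

module _ {A : Set} where

  infixl 5 _⊕_

  -- On memory types these unfold to the same terms as _⊗_ and loc, so the lemmas below apply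
  -- to memories and memory types alike.
  _⊕_ : ∀ {m} → Vec (List A) m → Vec (List A) m → Vec (List A) m
  _⊕_ = zipWith _++_

  single : ∀ {m} → Fin m → A → Vec (List A) m
  single a x = replicate _ [] [ a ]≔ [ x ]

  ⊕-assoc : ∀ {m} (S T U : Vec (List A) m) → (S ⊕ T) ⊕ U ≡ S ⊕ (T ⊕ U)
  ⊕-assoc = zipWith-assoc ++-assoc

  ⊕-identityˡ : ∀ {m} (S : Vec (List A) m) → replicate m [] ⊕ S ≡ S
  ⊕-identityˡ = zipWith-identityˡ ++-identityˡ

  ⊕-identityʳ : ∀ {m} (S : Vec (List A) m) → S ⊕ replicate m [] ≡ S
  ⊕-identityʳ = zipWith-identityʳ ++-identityʳ

  ⊕-[]%=-++ : ∀ {m} (F S : Vec (List A) m) a xs →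
              (F ⊕ S) [ a ]%= (_++ xs) ≡ F ⊕ (S [ a ]%= (_++ xs))
  ⊕-[]%=-++ (f ∷ F) (s ∷ S) zero    xs = cong (_∷ (F ⊕ S)) (++-assoc f s xs)
  ⊕-[]%=-++ (f ∷ F) (s ∷ S) (suc a) xs = cong ((f ++ s) ∷_) (⊕-[]%=-++ F S a xs)

  ⊕-[]≔ : ∀ {m} (F S : Vec (List A) m) a xs →
          (F ⊕ S) [ a ]≔ (lookup F a ++ xs) ≡ F ⊕ (S [ a ]≔ xs)
  ⊕-[]≔ (f ∷ F) (s ∷ S) zero    xs = refl
  ⊕-[]≔ (f ∷ F) (s ∷ S) (suc a) xs = cong ((f ++ s) ∷_) (⊕-[]≔ F S a xs)

  []%=-∷ʳ : ∀ {m} (S : Vec (List A) m) a x → S [ a ]%= (_++ [ x ]) ≡ S ⊕ single a x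
  []%=-∷ʳ (s ∷ S) zero    x = cong ((s ++ [ x ]) ∷_) (sym (⊕-identityʳ S))
  []%=-∷ʳ (s ∷ S) (suc a) x = cong₂ _∷_ (sym (++-identityʳ s)) ([]%=-∷ʳ S a x)

  lookup-⊕-single : ∀ {m} (S : Vec (List A) m) a x →
                    lookup (S ⊕ single a x) a ≡ lookup S a ++ [ x ]
  lookup-⊕-single (s ∷ S) zero    x = refl
  lookup-⊕-single (s ∷ S) (suc a) x = lookup-⊕-single S a x

  ⊕-single-[]≔ : ∀ {m} (S : Vec (List A) m) a x → (S ⊕ single a x) [ a ]≔ lookup S a ≡ S
  ⊕-single-[]≔ (s ∷ S) zero    x = cong (s ∷_) (⊕-identityʳ S)
  ⊕-single-[]≔ (s ∷ S) (suc a) x = cong₂ _∷_ (++-identityʳ s) (⊕-single-[]≔ S a x)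

module Congruence (n : ℕ) (mainLoc : Fin n) (B K : Set) (κ : K → B) where

  open FMC n mainLoc B K κ hiding (subst)

  private
    variable
      m : ℕ
      i : ℕ
      a : Fin n
      r t : Ty
      s u : StackTy
      Γ Δ : Ctx
      V V' W W' : Val
      M M' N N' : Comp
      xs xs' ys ys' : Stack
      σ τ ρ υ : Vec StackTy m
      S S' T T' U F F' X X' : Vec Stack m
      ξ : ℕ → ℕ
      γ γ' : ℕ → Val

  -- Renaming and substitution

  ext-cong : ∀ {ξ ξ'} → ξ ≗ ξ' → ext ξ ≗ ext ξ'
  ext-cong e zero    = refl
  ext-cong e (suc i) = cong suc (e i)

  exts-cong : ∀ {γ γ'} → γ ≗ γ' → exts γ ≗ exts γ'
  exts-cong e zero    = refl
  exts-cong e (suc i) = cong (renV suc) (e i)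

  mutual
    renC-cong : ∀ {ξ ξ'} → ξ ≗ ξ' → ∀ M → renC ξ M ≡ renC ξ' M
    renC-cong e ⋆            = refl
    renC-cong e (push V a M) = cong₂ (λ W → push W a) (renV-cong e V) (renC-cong e M)
    renC-cong e (pop a M)    = cong (pop a) (renC-cong (ext-cong e) M)
    renC-cong e (force V M)  = cong₂ force (renV-cong e V) (renC-cong e M)

    renV-cong : ∀ {ξ ξ'} → ξ ≗ ξ' → ∀ V → renV ξ V ≡ renV ξ' V
    renV-cong e (var i)  = cong var (e i)
    renV-cong e (con k)  = refl
    renV-cong e (bang M) = cong bang (renC-cong e M)

  mutual
    subC-cong : γ ≗ γ' → ∀ M → subC γ M ≡ subC γ' M
    subC-cong e ⋆            = refl
    subC-cong e (push V a M) = cong₂ (λ W → push W a) (subV-cong e V) (subC-cong e M)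
    subC-cong e (pop a M)    = cong (pop a) (subC-cong (exts-cong e) M)
    subC-cong e (force V M)  = cong₂ force (subV-cong e V) (subC-cong e M)

    subV-cong : γ ≗ γ' → ∀ V → subV γ V ≡ subV γ' V
    subV-cong e (var i)  = e i
    subV-cong e (con k)  = refl
    subV-cong e (bang M) = cong bang (subC-cong e M)

  mutual
    renC-renC : ∀ ξ ξ' M → renC ξ (renC ξ' M) ≡ renC (ξ ∘ ξ') M
    renC-renC ξ ξ' ⋆            = refl
    renC-renC ξ ξ' (push V a M) = cong₂ (λ W → push W a) (renV-renV ξ ξ' V) (renC-renC ξ ξ' M)
    renC-renC ξ ξ' (pop a M)    = cong (pop a) (trans (renC-renC (ext ξ) (ext ξ') M)
                                                      (renC-cong (λ { zero → refl ; (suc i) → refl }) M))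
    renC-renC ξ ξ' (force V M)  = cong₂ force (renV-renV ξ ξ' V) (renC-renC ξ ξ' M)

    renV-renV : ∀ ξ ξ' V → renV ξ (renV ξ' V) ≡ renV (ξ ∘ ξ') V
    renV-renV ξ ξ' (var i)  = refl
    renV-renV ξ ξ' (con k)  = refl
    renV-renV ξ ξ' (bang M) = cong bang (renC-renC ξ ξ' M)

  mutual
    subC-renC : ∀ γ ξ M → subC γ (renC ξ M) ≡ subC (γ ∘ ξ) M
    subC-renC γ ξ ⋆            = refl
    subC-renC γ ξ (push V a M) = cong₂ (λ W → push W a) (subV-renV γ ξ V) (subC-renC γ ξ M)
    subC-renC γ ξ (pop a M)    = cong (pop a) (trans (subC-renC (exts γ) (ext ξ) M)
                                                     (subC-cong (λ { zero → refl ; (suc i) → refl }) M))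
    subC-renC γ ξ (force V M)  = cong₂ force (subV-renV γ ξ V) (subC-renC γ ξ M)

    subV-renV : ∀ γ ξ V → subV γ (renV ξ V) ≡ subV (γ ∘ ξ) V
    subV-renV γ ξ (var i)  = refl
    subV-renV γ ξ (con k)  = refl
    subV-renV γ ξ (bang M) = cong bang (subC-renC γ ξ M)

  mutual
    renC-subC : ∀ ξ γ M → renC ξ (subC γ M) ≡ subC (renV ξ ∘ γ) M
    renC-subC ξ γ ⋆            = refl
    renC-subC ξ γ (push V a M) = cong₂ (λ W → push W a) (renV-subV ξ γ V) (renC-subC ξ γ M)
    renC-subC ξ γ (pop a M)    = cong (pop a) (trans (renC-subC (ext ξ) (exts γ) M) (subC-cong exts-comm M))
      where
        exts-comm : renV (ext ξ) ∘ exts γ ≗ exts (renV ξ ∘ γ)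
        exts-comm zero    = refl
        exts-comm (suc i) = trans (renV-renV (ext ξ) suc (γ i)) (sym (renV-renV suc ξ (γ i)))
    renC-subC ξ γ (force V M)  = cong₂ force (renV-subV ξ γ V) (renC-subC ξ γ M)

    renV-subV : ∀ ξ γ V → renV ξ (subV γ V) ≡ subV (renV ξ ∘ γ) V
    renV-subV ξ γ (var i)  = refl
    renV-subV ξ γ (con k)  = refl
    renV-subV ξ γ (bang M) = cong bang (renC-subC ξ γ M)

  mutual
    subC-subC : ∀ γ δ M → subC γ (subC δ M) ≡ subC (subV γ ∘ δ) M
    subC-subC γ δ ⋆            = refl
    subC-subC γ δ (push V a M) = cong₂ (λ W → push W a) (subV-subV γ δ V) (subC-subC γ δ M)
    subC-subC γ δ (pop a M)    = cong (pop a) (trans (subC-subC (exts γ) (exts δ) M) (subC-cong exts-comm M))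
      where
        exts-comm : subV (exts γ) ∘ exts δ ≗ exts (subV γ ∘ δ)
        exts-comm zero    = refl
        exts-comm (suc i) = trans (subV-renV (exts γ) suc (δ i)) (sym (renV-subV suc γ (δ i)))
    subC-subC γ δ (force V M)  = cong₂ force (subV-subV γ δ V) (subC-subC γ δ M)

    subV-subV : ∀ γ δ V → subV γ (subV δ V) ≡ subV (subV γ ∘ δ) V
    subV-subV γ δ (var i)  = refl
    subV-subV γ δ (con k)  = refl
    subV-subV γ δ (bang M) = cong bang (subC-subC γ δ M)

  mutual
    subC-id : ∀ M → subC var M ≡ M
    subC-id ⋆            = refl
    subC-id (push V a M) = cong₂ (λ W → push W a) (subV-id V) (subC-id M)
    subC-id (pop a M)    = cong (pop a) (trans (subC-cong (λ { zero → refl ; (suc i) → refl }) M) (subC-id M))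
    subC-id (force V M)  = cong₂ force (subV-id V) (subC-id M)

    subV-id : ∀ V → subV var V ≡ V
    subV-id (var i)  = refl
    subV-id (con k)  = refl
    subV-id (bang M) = cong bang (subC-id M)

  infixr 5 _•_

  _•_ : Val → (ℕ → Val) → ℕ → Val
  (W • γ) zero    = W
  (W • γ) (suc i) = γ i

  sub1-• : ∀ W M → sub1 W M ≡ subC (W • var) M
  sub1-• W M = subC-cong (λ { zero → refl ; (suc i) → refl }) M

  sub1-renC-suc : ∀ W M → sub1 W (renC suc M) ≡ M
  sub1-renC-suc W M = begin
    sub1 W (renC suc M)          ≡⟨ sub1-• W (renC suc M) ⟩
    subC (W • var) (renC suc M)  ≡⟨ subC-renC (W • var) suc M ⟩
    subC var M                   ≡⟨ subC-id M ⟩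
    M                            ∎
    where open ≡-Reasoning

  sub1-exts : ∀ W γ M → sub1 W (subC (exts γ) M) ≡ subC (W • γ) M
  sub1-exts W γ M = begin
    sub1 W (subC (exts γ) M)                   ≡⟨ sub1-• W _ ⟩
    subC (W • var) (subC (exts γ) M)           ≡⟨ subC-subC (W • var) (exts γ) M ⟩
    subC (subV (W • var) ∘ exts γ) M           ≡⟨ subC-cong exts-• M ⟩
    subC (W • γ) M                             ∎
    where
      open ≡-Reasoning
      exts-• : subV (W • var) ∘ exts γ ≗ W • γ
      exts-• zero    = refl
      exts-• (suc i) = trans (subV-renV (W • var) suc (γ i)) (subV-id (γ i))

  renC-︔ : ∀ ξ N M → renC ξ (N ︔ M) ≡ renC ξ N ︔ renC ξ M
  renC-︔ ξ ⋆            M = refl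
  renC-︔ ξ (push V a N) M = cong (push (renV ξ V) a) (renC-︔ ξ N M)
  renC-︔ ξ (pop a N)    M = cong (pop a) (trans (renC-︔ (ext ξ) N (renC suc M))
    (cong (renC (ext ξ) N ︔_) (trans (renC-renC (ext ξ) suc M) (sym (renC-renC suc ξ M)))))
  renC-︔ ξ (force V N)  M = cong (force (renV ξ V)) (renC-︔ ξ N M)

  subC-︔ : ∀ γ N M → subC γ (N ︔ M) ≡ subC γ N ︔ subC γ M
  subC-︔ γ ⋆            M = refl
  subC-︔ γ (push V a N) M = cong (push (subV γ V) a) (subC-︔ γ N M)
  subC-︔ γ (pop a N)    M = cong (pop a) (trans (subC-︔ (exts γ) N (renC suc M))
    (cong (subC (exts γ) N ︔_) (trans (subC-renC (exts γ) suc M) (sym (renC-subC suc γ M)))))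
  subC-︔ γ (force V N)  M = cong (force (subV γ V)) (subC-︔ γ N M)

  ︔-assoc : ∀ N M M' → (N ︔ M) ︔ M' ≡ N ︔ (M ︔ M')
  ︔-assoc ⋆            M M' = refl
  ︔-assoc (push V a N) M M' = cong (push V a) (︔-assoc N M M')
  ︔-assoc (pop a N)    M M' = cong (pop a) (trans (︔-assoc N (renC suc M) (renC suc M'))
                                                   (cong (N ︔_) (sym (renC-︔ suc M M'))))
  ︔-assoc (force V N)  M M' = cong (force V) (︔-assoc N M M')

  ︔-identityʳ : ∀ N → N ︔ ⋆ ≡ N
  ︔-identityʳ ⋆            = refl
  ︔-identityʳ (push V a N) = cong (push V a) (︔-identityʳ N)
  ︔-identityʳ (pop a N)    = cong (pop a) (︔-identityʳ N)
  ︔-identityʳ (force V N)  = cong (force V) (︔-identityʳ N)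

  sub1-︔ : ∀ W N M → sub1 W (N ︔ renC suc M) ≡ sub1 W N ︔ M
  sub1-︔ W N M = begin
    sub1 W (N ︔ renC suc M)                        ≡⟨ sub1-• W _ ⟩
    subC (W • var) (N ︔ renC suc M)                ≡⟨ subC-︔ (W • var) N (renC suc M) ⟩
    subC (W • var) N ︔ subC (W • var) (renC suc M) ≡⟨ cong₂ _︔_ (sym (sub1-• W N)) (sym (sub1-• W _)) ⟩
    sub1 W N ︔ sub1 W (renC suc M)                 ≡⟨ cong (sub1 W N ︔_) (sub1-renC-suc W M) ⟩
    sub1 W N ︔ M                                   ∎
    where open ≡-Reasoning

  run-︔⁺ : Run S N U → Run U M T → Run S (N ︔ M) T
  run-︔⁺ ε q = q
  run-︔⁺ (step-push ◅ p) q = step-push ◅ run-︔⁺ p q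
  run-︔⁺ {M = M} (step-pop {M = N} {V = W} e ◅ p) q =
    step-pop e ◅ subst (λ L → Run _ L _) (sym (sub1-︔ W N M)) (run-︔⁺ p q)
  run-︔⁺ {M = M} (step-force {N = L} {M = N} ◅ p) q =
    step-force ◅ subst (λ L' → Run _ L' _) (︔-assoc L N M) (run-︔⁺ p q)

  run-︔⁻ : ∀ N M → Run S (N ︔ M) T → Σ Mem λ U → Run S N U × Run U M T
  run-︔⁻ N M p = go N p refl
    where
      go : ∀ {S L} N → Star _↦_ (S , L) (T , ⋆) → L ≡ N ︔ M → Σ Mem λ U → Run S N U × Run U M T
      go ⋆ p refl = _ , ε , p
      go (push V a N) (step-push ◅ p) refl = let (U , q , q') = go N p refl in U , step-push ◅ q , q'
      go (pop a N) (step-pop {V = W} e ◅ p) refl =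
        let (U , q , q') = go (sub1 W N) p (sub1-︔ W N M) in U , step-pop e ◅ q , q'
      go (force V N) (step-force {N = L} ◅ p) refl =
        let (U , q , q') = go (L ︔ N) p (sym (︔-assoc L N M)) in U , step-force ◅ q , q'

  run-deterministic : Run S M T → Run S M T' → T ≡ T'
  run-deterministic ε ε = refl
  run-deterministic (step-push ◅ p) (step-push ◅ q) = run-deterministic p q
  run-deterministic (step-pop {s = s} e ◅ p) (step-pop {s = s'} e' ◅ q)
    with refl , refl ← ∷ʳ-injective s s' (trans (sym e) e') = run-deterministic p q
  run-deterministic (step-force ◅ p) (step-force ◅ q) = run-deterministic p q

  run-frame : ∀ F → Run S M T → Run (F ⊕ S) M (F ⊕ T)
  run-frame F ε = ε
  run-frame {S = S} F (step-push {V = W} {a = a} ◅ p) =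
    step-push ◅ subst (λ L → Run L _ _) (sym (⊕-[]%=-++ F S a [ W ])) (run-frame F p)
  run-frame {S = S} F (step-pop {a = a} {s = s} {V = W} e ◅ p) =
    step-pop e' ◅ subst (λ L → Run L _ _) (sym (⊕-[]≔ F S a s)) (run-frame F p)
    where
      e' : lookup (F ⊕ S) a ≡ (lookup F a ++ s) ++ [ W ]
      e' = trans (lookup-zipWith _++_ a F S)
                 (trans (cong (lookup F a ++_) e) (sym (++-assoc (lookup F a) s [ W ])))
  run-frame F (step-force ◅ p) = step-force ◅ run-frame F p

  run-push⁺ : Run (S ⊕ single a W) M T → Run S (push W a M) T
  run-push⁺ {S = S} {a = a} {W = W} p = step-push ◅ subst (λ L → Run L _ _) (sym ([]%=-∷ʳ S a W)) p

  run-push⁻ : Run S (push W a M) T → Run (S ⊕ single a W) M T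
  run-push⁻ {S = S} {W = W} {a = a} (step-push ◅ p) = subst (λ L → Run L _ _) ([]%=-∷ʳ S a W) p

  run-pop⁺ : Run S (sub1 W M) T → Run (S ⊕ single a W) (pop a M) T
  run-pop⁺ {S = S} {W = W} {a = a} p =
    step-pop (lookup-⊕-single S a W) ◅ subst (λ L → Run L _ _) (sym (⊕-single-[]≔ S a W)) p

  run-pop⁻ : Run (S ⊕ single a W) (pop a M) T → Run S (sub1 W M) T
  run-pop⁻ {S = S} {a = a} {W = W} (step-pop {s = s} e ◅ p)
    with refl , refl ← ∷ʳ-injective s (lookup S a) (trans (sym e) (lookup-⊕-single S a W)) =
    subst (λ L → Run L _ _) (⊕-single-[]≔ S a W) p

  run-force-bang⁺ : Run S N T → Run S (force (bang N) ⋆) T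
  run-force-bang⁺ {N = N} p = step-force ◅ subst (λ L → Run _ L _) (sym (︔-identityʳ N)) p

  run-force-bang⁻ : Run S (force (bang N) ⋆) T → Run S N T
  run-force-bang⁻ {N = N} (step-force ◅ p) = subst (λ L → Run _ L _) (︔-identityʳ N) p

  _⊢ʳ_∶_ : Ctx → (ℕ → ℕ) → Ctx → Set
  Δ ⊢ʳ ξ ∶ Γ = ∀ {i t} → Γ ∋ i ∶ t → Δ ∋ ξ i ∶ t

  _⊢ˢ_∶_ : Ctx → (ℕ → Val) → Ctx → Set
  Δ ⊢ˢ γ ∶ Γ = ∀ {i t} → Γ ∋ i ∶ t → Δ ⊢V γ i ∶ t

  ⊢ʳ-ext : Δ ⊢ʳ ξ ∶ Γ → (r ∷ Δ) ⊢ʳ ext ξ ∶ (r ∷ Γ)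
  ⊢ʳ-ext ⊢ξ here      = here
  ⊢ʳ-ext ⊢ξ (there x) = there (⊢ξ x)

  mutual
    renC-⊢ : Δ ⊢ʳ ξ ∶ Γ → Γ ⊢C M ∶ σ ⇒ τ → Δ ⊢C renC ξ M ∶ σ ⇒ τ
    renC-⊢ ⊢ξ ⊢⋆             = ⊢⋆
    renC-⊢ ⊢ξ (⊢push dV dM)  = ⊢push (renV-⊢ ⊢ξ dV) (renC-⊢ ⊢ξ dM)
    renC-⊢ ⊢ξ (⊢pop dM)      = ⊢pop (renC-⊢ (⊢ʳ-ext ⊢ξ) dM)
    renC-⊢ ⊢ξ (⊢force dV dM) = ⊢force (renV-⊢ ⊢ξ dV) (renC-⊢ ⊢ξ dM)

    renV-⊢ : Δ ⊢ʳ ξ ∶ Γ → Γ ⊢V V ∶ t → Δ ⊢V renV ξ V ∶ t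
    renV-⊢ ⊢ξ (⊢var x)   = ⊢var (⊢ξ x)
    renV-⊢ ⊢ξ ⊢con       = ⊢con
    renV-⊢ ⊢ξ (⊢bang dM) = ⊢bang (renC-⊢ ⊢ξ dM)

  ⊢ˢ-exts : Δ ⊢ˢ γ ∶ Γ → (r ∷ Δ) ⊢ˢ exts γ ∶ (r ∷ Γ)
  ⊢ˢ-exts ⊢γ here      = ⊢var here
  ⊢ˢ-exts ⊢γ (there x) = renV-⊢ there (⊢γ x)

  mutual
    subC-⊢ : Δ ⊢ˢ γ ∶ Γ → Γ ⊢C M ∶ σ ⇒ τ → Δ ⊢C subC γ M ∶ σ ⇒ τ
    subC-⊢ ⊢γ ⊢⋆             = ⊢⋆
    subC-⊢ ⊢γ (⊢push dV dM)  = ⊢push (subV-⊢ ⊢γ dV) (subC-⊢ ⊢γ dM)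
    subC-⊢ ⊢γ (⊢pop dM)      = ⊢pop (subC-⊢ (⊢ˢ-exts ⊢γ) dM)
    subC-⊢ ⊢γ (⊢force dV dM) = ⊢force (subV-⊢ ⊢γ dV) (subC-⊢ ⊢γ dM)

    subV-⊢ : Δ ⊢ˢ γ ∶ Γ → Γ ⊢V V ∶ t → Δ ⊢V subV γ V ∶ t
    subV-⊢ ⊢γ (⊢var x)   = ⊢γ x
    subV-⊢ ⊢γ ⊢con       = ⊢con
    subV-⊢ ⊢γ (⊢bang dM) = ⊢bang (subC-⊢ ⊢γ dM)

  ⊢-︔ : Γ ⊢C N ∶ ρ ⇒ σ → Γ ⊢C M ∶ σ ⇒ τ → Γ ⊢C N ︔ M ∶ ρ ⇒ τ
  ⊢-︔ ⊢⋆             dM = dM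
  ⊢-︔ (⊢push dV dN)  dM = ⊢push dV (⊢-︔ dN dM)
  ⊢-︔ (⊢pop dN)      dM = ⊢pop (⊢-︔ dN (renC-⊢ there dM))
  ⊢-︔ (⊢force dV dN) dM = ⊢force dV (⊢-︔ dN dM)

  ⊢-frame : ∀ υ → Γ ⊢C M ∶ σ ⇒ τ → Γ ⊢C M ∶ (υ ⊗ σ) ⇒ (υ ⊗ τ)
  ⊢-frame υ ⊢⋆ = ⊢⋆
  ⊢-frame υ (⊢push {a = a} {r = r} {σ = σ} dV dM) =
    ⊢push dV (subst (λ ρ → _ ⊢C _ ∶ ρ ⇒ _) (sym (⊕-assoc υ σ (loc a r))) (⊢-frame υ dM))
  ⊢-frame υ (⊢pop {a = a} {r = r} {σ = σ} dM) =
    subst (λ ρ → _ ⊢C _ ∶ ρ ⇒ _) (⊕-assoc υ σ (loc a r)) (⊢pop (⊢-frame υ dM))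
  ⊢-frame υ (⊢force {ρ = ρ} {σ = σ} {τ = τ} dV dM) =
    subst (λ ρ' → _ ⊢C _ ∶ ρ' ⇒ _) (⊕-assoc υ τ ρ)
      (⊢force dV (subst (λ σ' → _ ⊢C _ ∶ σ' ⇒ _) (sym (⊕-assoc υ τ σ)) (⊢-frame υ dM)))

  ⊢force-bang : Γ ⊢C N ∶ σ ⇒ τ → Γ ⊢C force (bang N) ⋆ ∶ σ ⇒ τ
  ⊢force-bang {σ = σ} {τ = τ} dN =
    subst₂ (_ ⊢C _ ∶_⇒_) (⊕-identityˡ σ) (⊕-identityˡ τ) (⊢force (⊢bang dN) ⊢⋆)

  ⊢force⋆-inversion : [] ⊢C force V ⋆ ∶ σ ⇒ τ → Σ Comp λ N → V ≡ bang N × [] ⊢C N ∶ σ ⇒ τ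
  ⊢force⋆-inversion (⊢force (⊢bang dN) ⊢⋆) = _ , refl , ⊢-frame _ dN

  TyRel : Set₁
  TyRel = Ty → Val → Val → Set

  data StackRel (R : TyRel) : StackTy → Stack → Stack → Set where
    []  : StackRel R [] [] []
    _∷_ : R t V V' → StackRel R s xs xs' → StackRel R (t ∷ s) (V ∷ xs) (V' ∷ xs')

  data MemRel (R : TyRel) : Vec StackTy m → Vec Stack m → Vec Stack m → Set where
    []  : MemRel R [] [] []
    _∷_ : StackRel R s xs xs' → MemRel R σ S S' → MemRel R (s ∷ σ) (xs ∷ S) (xs' ∷ S')

  data StackSplit (R : TyRel) (s u : StackTy) : Stack → Stack → Set where
    split : StackRel R s xs xs' → StackRel R u ys ys' → StackSplit R s u (xs ++ ys) (xs' ++ ys')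

  data MemSplit (R : TyRel) (σ τ : Vec StackTy m) : Vec Stack m → Vec Stack m → Set where
    split : MemRel R σ F F' → MemRel R τ X X' → MemSplit R σ τ (F ⊕ X) (F' ⊕ X')

  data Cell (R : TyRel) (a : Fin m) (r : Ty) : Vec Stack m → Vec Stack m → Set where
    cell : R r W W' → Cell R a r (single a W) (single a W')

  module _ {R : TyRel} where

    StackRel-++⁺ : StackRel R s xs xs' → StackRel R u ys ys' → StackRel R (s ++ u) (xs ++ ys) (xs' ++ ys')
    StackRel-++⁺ []       h = h
    StackRel-++⁺ (g ∷ gs) h = g ∷ StackRel-++⁺ gs h

    StackRel-++⁻ : ∀ s → StackRel R (s ++ u) xs xs' → StackSplit R s u xs xs'
    StackRel-++⁻ []      h = split [] h
    StackRel-++⁻ (_ ∷ s) (g ∷ gs) with StackRel-++⁻ s gs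
    ... | split h₁ h₂ = split (g ∷ h₁) h₂

    MemRel-⊕⁺ : MemRel R σ F F' → MemRel R τ X X' → MemRel R (σ ⊕ τ) (F ⊕ X) (F' ⊕ X')
    MemRel-⊕⁺ []       []       = []
    MemRel-⊕⁺ (g ∷ gs) (h ∷ hs) = StackRel-++⁺ g h ∷ MemRel-⊕⁺ gs hs

    MemRel-⊕⁻ : ∀ (σ τ : Vec StackTy m) → MemRel R (σ ⊕ τ) S S' → MemSplit R σ τ S S'
    MemRel-⊕⁻ []      []      []       = split [] []
    MemRel-⊕⁻ (s ∷ σ) (u ∷ τ) (h ∷ hs) with StackRel-++⁻ s h | MemRel-⊕⁻ σ τ hs
    ... | split g₁ g₂ | split h₁ h₂ = split (g₁ ∷ h₁) (g₂ ∷ h₂)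

    MemRel-replicate⁺ : ∀ m → MemRel R (replicate m []) (replicate m []) (replicate m [])
    MemRel-replicate⁺ zero    = []
    MemRel-replicate⁺ (suc m) = [] ∷ MemRel-replicate⁺ m

    MemRel-replicate⁻ : MemRel R (replicate m []) S S' → S ≡ replicate m [] × S' ≡ replicate m []
    MemRel-replicate⁻ []        = refl , refl
    MemRel-replicate⁻ ([] ∷ hs) with refl , refl ← MemRel-replicate⁻ hs = refl , refl

    MemRel-single⁺ : ∀ (a : Fin m) → R r W W' → MemRel R (single a r) (single a W) (single a W')
    MemRel-single⁺ zero    h = (h ∷ []) ∷ MemRel-replicate⁺ _
    MemRel-single⁺ (suc a) h = [] ∷ MemRel-single⁺ a h

    MemRel-single⁻ : ∀ (a : Fin m) → MemRel R (single a r) S S' → Cell R a r S S'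
    MemRel-single⁻ zero ((h ∷ []) ∷ hs) with refl , refl ← MemRel-replicate⁻ hs = cell h
    MemRel-single⁻ (suc a) ([] ∷ hs) with MemRel-single⁻ a hs
    ... | cell h = cell h

  StackEq⇒StackRel : ∀ s xs xs' → StackEq s xs xs' → StackRel ValEq s xs xs'
  StackEq⇒StackRel []      []       []         _        = []
  StackEq⇒StackRel []      []       (_ ∷ _)    ()
  StackEq⇒StackRel []      (_ ∷ _)  _          ()
  StackEq⇒StackRel (_ ∷ _) []       _          ()
  StackEq⇒StackRel (_ ∷ _) (_ ∷ _)  []         ()
  StackEq⇒StackRel (t ∷ s) (V ∷ xs) (V' ∷ xs') (h , hs) = h ∷ StackEq⇒StackRel s xs xs' hs

  MemEq⇒MemRel : ∀ (σ : Vec StackTy m) {S S'} → MemEq σ S S' → MemRel ValEq σ S S'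
  MemEq⇒MemRel []      {[]}     {[]}       _        = []
  MemEq⇒MemRel (s ∷ σ) {xs ∷ S} {xs' ∷ S'} (h , hs) = StackEq⇒StackRel s xs xs' h ∷ MemEq⇒MemRel σ hs

  StackRel⇒StackEq : StackRel ValEq s xs xs' → StackEq s xs xs'
  StackRel⇒StackEq []       = tt
  StackRel⇒StackEq (h ∷ hs) = h , StackRel⇒StackEq hs

  MemRel⇒MemEq : MemRel ValEq σ S S' → MemEq σ S S'
  MemRel⇒MemEq []       = tt
  MemRel⇒MemEq (h ∷ hs) = StackRel⇒StackEq h , MemRel⇒MemEq hs

  -- Termination

  mutual
    RedV : Ty → Val → Set
    RedV (base β)  V = ⊤
    RedV (arr σ τ) V = Σ Comp λ N → V ≡ bang N × RedC σ τ N

    RedC : MemTy → MemTy → Comp → Set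
    RedC σ τ M = ∀ S → RedMem σ S → Σ Mem λ T → Run S M T × RedMem τ T

    RedMem : Vec StackTy m → Vec Stack m → Set
    RedMem []      []       = ⊤
    RedMem (s ∷ σ) (xs ∷ S) = RedStack s xs × RedMem σ S

    RedStack : StackTy → Stack → Set
    RedStack []      []       = ⊤
    RedStack (t ∷ s) (V ∷ xs) = RedV t V × RedStack s xs
    RedStack _       _        = ⊥

  -- RedV as a relation on the diagonal, so that the lemmas on MemRel serve both logical relations.
  RedRel : TyRel
  RedRel t V _ = RedV t V

  RedStack⇒StackRel : ∀ s xs → RedStack s xs → StackRel RedRel s xs xs
  RedStack⇒StackRel []      []       _        = []
  RedStack⇒StackRel []      (_ ∷ _)  ()
  RedStack⇒StackRel (_ ∷ _) []       ()
  RedStack⇒StackRel (t ∷ s) (V ∷ xs) (h , hs) = h ∷ RedStack⇒StackRel s xs hs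

  RedMem⇒MemRel : ∀ (σ : Vec StackTy m) {S} → RedMem σ S → MemRel RedRel σ S S
  RedMem⇒MemRel []      {[]}     _        = []
  RedMem⇒MemRel (s ∷ σ) {xs ∷ S} (h , hs) = RedStack⇒StackRel s xs h ∷ RedMem⇒MemRel σ hs

  module _ {R : TyRel} (R⇒RedV : ∀ {t V V'} → R t V V' → RedV t V) where

    StackRel⇒RedStack : StackRel R s xs xs' → RedStack s xs
    StackRel⇒RedStack []       = tt
    StackRel⇒RedStack (h ∷ hs) = R⇒RedV h , StackRel⇒RedStack hs

    MemRel⇒RedMem : MemRel R σ S S' → RedMem σ S
    MemRel⇒RedMem []       = tt
    MemRel⇒RedMem (h ∷ hs) = StackRel⇒RedStack h , MemRel⇒RedMem hs

  RedC-︔ : RedC ρ σ N → RedC σ τ M → RedC ρ τ (N ︔ M)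
  RedC-︔ hN hM S h =
    let (U , p , hU) = hN S h
        (T , q , hT) = hM U hU
    in T , run-︔⁺ p q , hT

  RedC-frame : ∀ υ → RedC ρ σ M → RedC (υ ⊗ ρ) (υ ⊗ σ) M
  RedC-frame {ρ = ρ} {σ = σ} {M = M} υ hM S h = framed (MemRel-⊕⁻ υ ρ (RedMem⇒MemRel _ h))
    where
      framed : ∀ {S'} → MemSplit RedRel υ ρ S S' → Σ Mem λ T → Run S M T × RedMem (υ ⊗ σ) T
      framed (split {F = F} hF hX) =
        let (U , p , hU) = hM _ (MemRel⇒RedMem id hX)
        in F ⊕ U , run-frame F p , MemRel⇒RedMem id (MemRel-⊕⁺ hF (RedMem⇒MemRel σ hU))

  RedC-push : RedV r W → RedC (σ ⊗ loc a r) τ M → RedC σ τ (push W a M)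
  RedC-push {W = W} {σ = σ} {a = a} hW hM S h =
    let h' = MemRel-⊕⁺ (RedMem⇒MemRel σ h) (MemRel-single⁺ {W' = W} a hW)
        (T , p , hT) = hM _ (MemRel⇒RedMem id h')
    in T , run-push⁺ p , hT

  RedC-pop : (∀ {W} → RedV r W → RedC σ τ (sub1 W M)) → RedC (σ ⊗ loc a r) τ (pop a M)
  RedC-pop {r = r} {σ = σ} {τ = τ} {M = M} {a = a} hM S h =
    popped (MemRel-⊕⁻ σ (loc a r) (RedMem⇒MemRel _ h))
    where
      popped : ∀ {S'} → MemSplit RedRel σ (loc a r) S S' → Σ Mem λ T → Run S (pop a M) T × RedMem τ T
      popped (split hF hX) with MemRel-single⁻ a hX
      ... | cell hW = let (T , p , hT) = hM hW _ (MemRel⇒RedMem id hF) in T , run-pop⁺ p , hT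

  RedV-force : RedV (arr σ τ) W → RedC σ τ (force W ⋆)
  RedV-force (N , refl , hN) S h = let (T , p , hT) = hN S h in T , run-force-bang⁺ p , hT

  RedSub : Ctx → (ℕ → Val) → Set
  RedSub Γ γ = ∀ {i t} → Γ ∋ i ∶ t → RedV t (γ i)

  mutual
    ⊢C⇒RedC : Γ ⊢C M ∶ σ ⇒ τ → RedSub Γ γ → RedC σ τ (subC γ M)
    ⊢C⇒RedC ⊢⋆ hγ S h = S , ε , h
    ⊢C⇒RedC (⊢push dV dM) hγ = RedC-push (⊢V⇒RedV dV hγ) (⊢C⇒RedC dM hγ)
    ⊢C⇒RedC {γ = γ} (⊢pop {M = M} dM) hγ = RedC-pop λ {W} hW →
      subst (RedC _ _) (sym (sub1-exts W γ M)) (⊢C⇒RedC dM λ { here → hW ; (there x) → hγ x })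
    ⊢C⇒RedC (⊢force {τ = τ} dV dM) hγ =
      RedC-︔ (RedC-frame τ (RedV-force (⊢V⇒RedV dV hγ))) (⊢C⇒RedC dM hγ)

    ⊢V⇒RedV : Γ ⊢V V ∶ t → RedSub Γ γ → RedV t (subV γ V)
    ⊢V⇒RedV (⊢var x)   hγ = hγ x
    ⊢V⇒RedV ⊢con       hγ = tt
    ⊢V⇒RedV (⊢bang dM) hγ = _ , refl , ⊢C⇒RedC dM hγ

  run-exists : [] ⊢C M ∶ σ ⇒ τ → RedMem σ S → Σ Mem (Run S M)
  run-exists {M = M} {S = S} dM h =
    let (T , p , _) = ⊢C⇒RedC dM (λ ()) S h in T , subst (λ L → Run S L T) (subC-id M) p

  RedV-closed : [] ⊢V V ∶ t → RedV t V
  RedV-closed {V = V} {t = t} dV = subst (RedV t) (subV-id V) (⊢V⇒RedV dV (λ ()))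

  -- Machine equivalence of closed terms

  RunEq : MemTy → MemTy → Comp → Comp → Set
  RunEq σ τ M M' = ∀ S S' → MemEq σ S S' → ∀ T T' → Run S M T → Run S' M' T' → MemEq τ T T'

  ValEq-typed : ∀ t → ValEq t V V' → [] ⊢V V ∶ t × [] ⊢V V' ∶ t
  ValEq-typed (base _)  (k , refl , refl , refl) = ⊢con , ⊢con
  ValEq-typed (arr σ τ) (dW , dW' , _)
    with _ , refl , dN ← ⊢force⋆-inversion dW | _ , refl , dN' ← ⊢force⋆-inversion dW' =
    ⊢bang dN , ⊢bang dN'

  ValEq⇒RedV : ∀ t → ValEq t V V' → RedV t V
  ValEq⇒RedV t h = RedV-closed (proj₁ (ValEq-typed t h))

  MemRel-ValEq⇒RedMem : MemRel ValEq σ S S' → RedMem σ S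
  MemRel-ValEq⇒RedMem = MemRel⇒RedMem (λ {t} → ValEq⇒RedV t)

  mutual
    ValEq-sym : ∀ t → ValEq t V V' → ValEq t V' V
    ValEq-sym (base _)  (k , e , e₁ , e₂) = k , e , e₂ , e₁
    ValEq-sym (arr σ τ) h = CompEq-sym σ τ h

    CompEq-sym : ∀ σ τ → CompEq σ τ M M' → CompEq σ τ M' M
    CompEq-sym σ τ (dM , dM' , hM) =
      dM' , dM , λ S S' h T T' p p' → MemEq-sym τ (hM S' S (MemEq-sym σ h) T' T p' p)

    MemEq-sym : ∀ (σ : MemTy) → MemEq σ S S' → MemEq σ S' S
    MemEq-sym σ h = MemRel⇒MemEq (MemRel-sym σ (MemEq⇒MemRel σ h))

    MemRel-sym : ∀ (σ : Vec StackTy m) → MemRel ValEq σ S S' → MemRel ValEq σ S' S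
    MemRel-sym []      []       = []
    MemRel-sym (s ∷ σ) (h ∷ hs) = StackRel-sym s h ∷ MemRel-sym σ hs

    StackRel-sym : ∀ s → StackRel ValEq s xs xs' → StackRel ValEq s xs' xs
    StackRel-sym []      []       = []
    StackRel-sym (t ∷ s) (h ∷ hs) = ValEq-sym t h ∷ StackRel-sym s hs

  mutual
    ValEq-trans : ∀ t {V₁ V₂ V₃} → ValEq t V₁ V₂ → ValEq t V₂ V₃ → ValEq t V₁ V₃
    ValEq-trans (base _)  (k , e , e₁ , refl) (_ , _ , refl , e₃) = k , e , e₁ , e₃
    ValEq-trans (arr σ τ) h h' = CompEq-trans σ τ h h'

    CompEq-trans : ∀ σ τ {M₁ M₂ M₃} →
                   CompEq σ τ M₁ M₂ → CompEq σ τ M₂ M₃ → CompEq σ τ M₁ M₃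
    CompEq-trans σ τ (dM₁ , dM₂ , hM) (_ , dM₃ , hM') = dM₁ , dM₃ , λ S S₃ h T T₃ p p₃ →
      let (T₂ , p₂) = run-exists dM₂ (MemRel-ValEq⇒RedMem (MemRel-sym σ (MemEq⇒MemRel σ h)))
          h₃ = MemEq-trans σ (MemEq-sym σ h) h
      in MemEq-trans τ (hM S S₃ h T T₂ p p₂) (hM' S₃ S₃ h₃ T₂ T₃ p₂ p₃)

    MemEq-trans : ∀ (σ : MemTy) {S₁ S₂ S₃} → MemEq σ S₁ S₂ → MemEq σ S₂ S₃ → MemEq σ S₁ S₃
    MemEq-trans σ h h' = MemRel⇒MemEq (MemRel-trans σ (MemEq⇒MemRel σ h) (MemEq⇒MemRel σ h'))

    MemRel-trans : ∀ (σ : Vec StackTy m) {S₁ S₂ S₃} →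
                   MemRel ValEq σ S₁ S₂ → MemRel ValEq σ S₂ S₃ → MemRel ValEq σ S₁ S₃
    MemRel-trans []      []       []       = []
    MemRel-trans (s ∷ σ) (h ∷ hs) (g ∷ gs) = StackRel-trans s h g ∷ MemRel-trans σ hs gs

    StackRel-trans : ∀ s {xs₁ xs₂ xs₃} →
                     StackRel ValEq s xs₁ xs₂ → StackRel ValEq s xs₂ xs₃ → StackRel ValEq s xs₁ xs₃
    StackRel-trans []      []       []       = []
    StackRel-trans (t ∷ s) (h ∷ hs) (g ∷ gs) = ValEq-trans t h g ∷ StackRel-trans s hs gs

  CompEq-⋆ : CompEq τ τ ⋆ ⋆
  CompEq-⋆ = ⊢⋆ , ⊢⋆ , λ { S S' h .S .S' ε ε → h }

  ValEq-bang : CompEq σ τ N N' → ValEq (arr σ τ) (bang N) (bang N')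
  ValEq-bang (dN , dN' , hN) =
    ⊢force-bang dN , ⊢force-bang dN' ,
    λ S S' h T T' p p' → hN S S' h T T' (run-force-bang⁻ p) (run-force-bang⁻ p')

  CompEq-push : ValEq r W W' → CompEq (σ ⊗ loc a r) τ M M' → CompEq σ τ (push W a M) (push W' a M')
  CompEq-push {r = r} {W = W} {W' = W'} {σ = σ} {a = a} hW (dM , dM' , hM) =
    let (dW , dW') = ValEq-typed r hW in
    ⊢push dW dM , ⊢push dW' dM' , λ S S' h T T' p p' →
      hM (S ⊕ single a W) (S' ⊕ single a W')
         (MemRel⇒MemEq (MemRel-⊕⁺ (MemEq⇒MemRel σ h) (MemRel-single⁺ a hW)))
         T T' (run-push⁻ p) (run-push⁻ p')

  CompEq-pop : [ r ] ⊢C M ∶ σ ⇒ τ → [ r ] ⊢C M' ∶ σ ⇒ τ →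
               (∀ {W W'} → ValEq r W W' → CompEq σ τ (sub1 W M) (sub1 W' M')) →
               CompEq (σ ⊗ loc a r) τ (pop a M) (pop a M')
  CompEq-pop {r = r} {M = M} {σ = σ} {τ = τ} {M' = M'} {a = a} dM dM' hM =
    ⊢pop dM , ⊢pop dM' , related
    where
      related : RunEq (σ ⊗ loc a r) τ (pop a M) (pop a M')
      related S S' h T T' p p' with MemRel-⊕⁻ σ (loc a r) (MemEq⇒MemRel _ h)
      ... | split {F = F} {F' = F'} hF hX with MemRel-single⁻ a hX
      ... | cell hW = proj₂ (proj₂ (hM hW)) F F' (MemRel⇒MemEq hF) T T' (run-pop⁻ p) (run-pop⁻ p')

  CompEq-︔ : ∀ {ρ σ τ : MemTy} {N N' M M'} →
            CompEq ρ σ N N' → CompEq σ τ M M' → CompEq ρ τ (N ︔ M) (N' ︔ M')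
  CompEq-︔ {N = N} {N'} {M} {M'} (dN , dN' , hN) (dM , dM' , hM) =
    ⊢-︔ dN dM , ⊢-︔ dN' dM' , λ S S' h T T' p p' →
      let (U , q₁ , q₂) = run-︔⁻ N M p
          (U' , q₁' , q₂') = run-︔⁻ N' M' p'
      in hM U U' (hN S S' h U U' q₁ q₁') T T' q₂ q₂'

  run-framed⁻ : [] ⊢C M ∶ ρ ⇒ σ → RedMem ρ X → Run (F ⊕ X) M T →
                Σ Mem λ U → Run X M U × T ≡ F ⊕ U
  run-framed⁻ {F = F} dM hX p =
    let (U , q) = run-exists dM hX in U , q , run-deterministic p (run-frame F q)

  CompEq-frame : ∀ υ → CompEq ρ σ M M' → CompEq (υ ⊗ ρ) (υ ⊗ σ) M M'
  CompEq-frame {ρ = ρ} {σ = σ} {M = M} {M' = M'} υ (dM , dM' , hM) =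
    ⊢-frame υ dM , ⊢-frame υ dM' , related
    where
      related : RunEq (υ ⊗ ρ) (υ ⊗ σ) M M'
      related S S' h T T' p p' with MemRel-⊕⁻ υ ρ (MemEq⇒MemRel _ h)
      ... | split {X = X} {X' = X'} hF hX
        with U , q , refl ← run-framed⁻ dM (MemRel-ValEq⇒RedMem hX) p
           | U' , q' , refl ← run-framed⁻ dM' (MemRel-ValEq⇒RedMem (MemRel-sym ρ hX)) p' =
        MemRel⇒MemEq (MemRel-⊕⁺ hF (MemEq⇒MemRel σ (hM X X' (MemRel⇒MemEq hX) U U' q q')))

  -- Machine equivalence of open terms

  SubEq⇒⊢ˢ : SubEq Γ γ γ' → [] ⊢ˢ γ ∶ Γ × [] ⊢ˢ γ' ∶ Γ
  SubEq⇒⊢ˢ hγ = (λ {_} {t} x → proj₁ (ValEq-typed t (hγ x)))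
              , (λ {_} {t} x → proj₂ (ValEq-typed t (hγ x)))

  Equiv-var : Γ ∋ i ∶ t → Equiv val Γ t (var i) (var i)
  Equiv-var x = ⊢var x , ⊢var x , λ γ γ' hγ → hγ x

  Equiv-con : ∀ {k} → Equiv val Γ (base (κ k)) (con k) (con k)
  Equiv-con {k = k} = ⊢con , ⊢con , λ _ _ _ → k , refl , refl , refl

  Equiv-bang : Equiv comp Γ (σ , τ) M M' → Equiv val Γ (arr σ τ) (bang M) (bang M')
  Equiv-bang (dM , dM' , hM) = ⊢bang dM , ⊢bang dM' , λ γ γ' hγ → ValEq-bang (hM γ γ' hγ)

  Equiv-⋆ : Equiv comp Γ (τ , τ) ⋆ ⋆
  Equiv-⋆ = ⊢⋆ , ⊢⋆ , λ _ _ _ → CompEq-⋆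

  Equiv-push : Equiv val Γ r V V' → Equiv comp Γ (σ ⊗ loc a r , τ) M M' →
               Equiv comp Γ (σ , τ) (push V a M) (push V' a M')
  Equiv-push (dV , dV' , hV) (dM , dM' , hM) =
    ⊢push dV dM , ⊢push dV' dM' , λ γ γ' hγ → CompEq-push (hV γ γ' hγ) (hM γ γ' hγ)

  Equiv-pop : Equiv comp (r ∷ Γ) (σ , τ) M M' → Equiv comp Γ (σ ⊗ loc a r , τ) (pop a M) (pop a M')
  Equiv-pop {M = M} {M' = M'} (dM , dM' , hM) = ⊢pop dM , ⊢pop dM' , λ γ γ' hγ →
    let (⊢γ , ⊢γ') = SubEq⇒⊢ˢ hγ in
    CompEq-pop (subC-⊢ (⊢ˢ-exts ⊢γ) dM) (subC-⊢ (⊢ˢ-exts ⊢γ') dM') λ {W} {W'} hW →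
      subst₂ (CompEq _ _) (sym (sub1-exts W γ M)) (sym (sub1-exts W' γ' M'))
        (hM (W • γ) (W' • γ') λ { here → hW ; (there x) → hγ x })

  Equiv-force : Equiv val Γ (arr ρ σ) V V' → Equiv comp Γ (τ ⊗ σ , υ) M M' →
                Equiv comp Γ (τ ⊗ ρ , υ) (force V M) (force V' M')
  Equiv-force {τ = τ} (dV , dV' , hV) (dM , dM' , hM) =
    ⊢force dV dM , ⊢force dV' dM' , λ γ γ' hγ →
      CompEq-︔ (CompEq-frame τ (hV γ γ' hγ)) (hM γ γ' hγ)

  mutual
    Equiv-reflC : Γ ⊢C M ∶ σ ⇒ τ → Equiv comp Γ (σ , τ) M M
    Equiv-reflC ⊢⋆             = Equiv-⋆
    Equiv-reflC (⊢push dV dM)  = Equiv-push (Equiv-reflV dV) (Equiv-reflC dM)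
    Equiv-reflC (⊢pop dM)      = Equiv-pop (Equiv-reflC dM)
    Equiv-reflC (⊢force dV dM) = Equiv-force (Equiv-reflV dV) (Equiv-reflC dM)

    Equiv-reflV : Γ ⊢V V ∶ t → Equiv val Γ t V V
    Equiv-reflV (⊢var x)   = Equiv-var x
    Equiv-reflV ⊢con       = Equiv-con
    Equiv-reflV (⊢bang dM) = Equiv-bang (Equiv-reflC dM)

  Equiv-refl : ∀ s {T : Typ s} {X} → Γ ⊢[ s ] X ∶ T → Equiv s Γ T X X
  Equiv-refl comp = Equiv-reflC
  Equiv-refl val  = Equiv-reflV

  ClosedEq-sym : ∀ s (T : Typ s) {X Y} → ClosedEq s T X Y → ClosedEq s T Y X
  ClosedEq-sym comp (σ , τ) = CompEq-sym σ τ
  ClosedEq-sym val  t       = ValEq-sym t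

  ClosedEq-trans : ∀ s (T : Typ s) {X Y Z} → ClosedEq s T X Y → ClosedEq s T Y Z → ClosedEq s T X Z
  ClosedEq-trans comp (σ , τ) = CompEq-trans σ τ
  ClosedEq-trans val  t       = ValEq-trans t

  Equiv-sym : ∀ s (T : Typ s) {X Y} → Equiv s Γ T X Y → Equiv s Γ T Y X
  Equiv-sym s T (dX , dY , h) =
    dY , dX , λ γ γ' hγ → ClosedEq-sym s T (h γ' γ λ {_} {t} x → ValEq-sym t (hγ x))

  Equiv-trans : ∀ s (T : Typ s) {X Y Z} → Equiv s Γ T X Y → Equiv s Γ T Y Z → Equiv s Γ T X Z
  Equiv-trans s T (dX , _ , h) (_ , dZ , h') =
    dX , dZ , λ γ γ' hγ →
      ClosedEq-trans s T (h γ γ' hγ)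
        (h' γ' γ' λ {_} {t} x → ValEq-trans t (ValEq-sym t (hγ x)) (hγ x))

  Equiv-plug : ∀ {h s} {T : Typ h} {T' : Typ s} {C : TC h s} {X Y} →
               TCTy Δ T Γ C T' → Equiv h Δ T X Y → Equiv s Γ T' (plug C X) (plug C Y)
  Equiv-plug ty-hole              e = e
  Equiv-plug (ty-push-v tC dM)    e = Equiv-push (Equiv-plug tC e) (Equiv-reflC dM)
  Equiv-plug (ty-push-c dV tC)    e = Equiv-push (Equiv-reflV dV) (Equiv-plug tC e)
  Equiv-plug (ty-pop tC)          e = Equiv-pop (Equiv-plug tC e)
  Equiv-plug (ty-force-v tC dM)   e = Equiv-force (Equiv-plug tC e) (Equiv-reflC dM)
  Equiv-plug (ty-force-c dV tC)   e = Equiv-force (Equiv-reflV dV) (Equiv-plug tC e)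
  Equiv-plug (ty-bang tC)         e = Equiv-bang (Equiv-plug tC e)

mainTheorem7 : (n : ℕ) (mainLoc : Fin n) (B K : Set) (κ : K → B) →
    FMC.IsCongruence n mainLoc B K κ
mainTheorem7 n mainLoc B K κ = record
  { reflexive  = λ s _ _ _ → Equiv-refl s
  ; symmetric  = λ s _ T _ _ → Equiv-sym s T
  ; transitive = λ s _ T _ _ _ → Equiv-trans s T
  ; congruent  = λ _ _ _ _ _ _ _ _ _ → Equiv-plug
  }
  where open Congruence n mainLoc B K κ
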